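{- Let $(A_n)_{n\ge0}$ be a sequence in $\mathrm M_l(\mathcal{O}_K)$ and $\alpha\in\mathcal{O}_K$, with $A_0=I$. Then the following are equivalent: (1) for every $n\ge0$, $\sum_{i,j\ge0}A_{n+i}A_j(-1)^i(1-\alpha X)^{ -n-i}X^{[i]}X^{[j]}=A_n$; (2) for every $n\ge0$, $A_{n+1}=\prod_{i=0}^n(i\alpha+A_1)$.
   Context: $\mathcal{O}_K$ is the ring of integers of a $p$-adic field $K$. $X^{[i]}=X^i/i!$, and the identity in (1) is understood in $\mathrm M_l$ of the ($p$-complete) pd-polynomial algebra $\mathcal{O}_K\{X\}^\wedge_{\mathrm{pd}}$, equivalently coefficientwise in formal power series in $X$ over $K$, after expanding $(1-\alpha X)^{ -m}=\sum_{k\ge0}\binom{m+k-1}{k}\alpha^kX^k$; each coefficient of $X^{[N]}$ is then a finite sum. -}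

module Defs where

open import Level using (Level)
open import Algebra.Bundles using (CommutativeRing)
open import Data.Nat as ℕ using (ℕ; zero; suc; _∸_; _!)
open import Data.Nat.Combinatorics using (_C_)
open import Data.Fin as F using (Fin; _≟_)
open import Relation.Nullary using (yes; no)

module _ {c ℓ : Level} (R : CommutativeRing c ℓ) where
  open CommutativeRing R using (Carrier; _≈_; _+_; _*_; -_; 0#; 1#)

  fromℕ : ℕ → Carrier
  fromℕ zero    = 0#
  fromℕ (suc n) = 1# + fromℕ n

  sign : ℕ → Carrier
  sign zero    = 1#
  sign (suc i) = - sign i

  pow : Carrier → ℕ → Carrier
  pow x zero    = 1#
  pow x (suc k) = x * pow x k

  sumTo : ℕ → (ℕ → Carrier) → Carrier
  sumTo zero    f = f 0
  sumTo (suc N) f = sumTo N f + f (suc N)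

  sumFin : ∀ {l} → (Fin l → Carrier) → Carrier
  sumFin {zero}  f = 0#
  sumFin {suc l} f = f F.zero + sumFin (λ i → f (F.suc i))

  Mat : ℕ → Set c
  Mat l = Fin l → Fin l → Carrier

  _≈M_ : ∀ {l} → Mat l → Mat l → Set ℓ
  A ≈M B = ∀ i j → A i j ≈ B i j

  _*M_ : ∀ {l} → Mat l → Mat l → Mat l
  (A *M B) i j = sumFin (λ k → A i k * B k j)

  _+M_ : ∀ {l} → Mat l → Mat l → Mat l
  (A +M B) i j = A i j + B i j

  _·M_ : ∀ {l} → Carrier → Mat l → Mat l
  (a ·M A) i j = a * A i j

  0M : ∀ {l} → Mat l
  0M i j = 0#

  IM : ∀ {l} → Mat l
  IM i j with i ≟ j
  ... | yes _ = 1#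
  ... | no  _ = 0#

  sumToM : ∀ {l} → ℕ → (ℕ → Mat l) → Mat l
  sumToM zero    f = f 0
  sumToM (suc N) f = sumToM N f +M f (suc N)

  -- Divided-power series over R:  f ↦ Σ_N f(N) X^{[N]}  with
  -- X^{[a]} X^{[b]} = C(a+b,a) X^{[a+b]}.  Each coefficient of a product
  -- is a finite sum, so elements of the p-complete pd-polynomial algebra
  -- are represented by their coefficient sequences ℕ → R.
  PD : Set c
  PD = ℕ → Carrier

  _⋆_ : PD → PD → PD
  (f ⋆ g) N = sumTo N (λ a → fromℕ (N C a) * (f a * g (N ∸ a)))

  Xpd : ℕ → PD
  Xpd zero    zero    = 1#
  Xpd zero    (suc N) = 0#
  Xpd (suc i) zero    = 0#
  Xpd (suc i) (suc N) = Xpd i N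

  -- (1 - αX)^{-m} = Σ_k C(m+k-1,k) α^k X^k = Σ_k C(m+k-1,k) α^k k! X^{[k]}
  -- (for m = 0 this is 1, since C(k-1,k) = 0 for k ≥ 1 and C(0,0) = 1)
  invPow : Carrier → ℕ → PD
  invPow α m k = fromℕ (((m ℕ.+ k) ∸ 1) C k) * (pow α k * fromℕ (k !))

  coeffTerm : Carrier → ℕ → ℕ → ℕ → ℕ → Carrier
  coeffTerm α n i j N = ((invPow α (n ℕ.+ i) ⋆ Xpd i) ⋆ Xpd j) N

  -- coefficient of X^{[N]} in
  --   Σ_{i,j≥0} A_{n+i} A_j (-1)^i (1-αX)^{-n-i} X^{[i]} X^{[j]}
  -- (terms with i > N or j > N have vanishing X^{[N]}-coefficient)
  lhsCoeff : ∀ {l} → (ℕ → Mat l) → Carrier → ℕ → ℕ → Mat l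
  lhsCoeff A α n N =
    sumToM N (λ i → sumToM N (λ j →
      (sign i * coeffTerm α n i j N) ·M (A (n ℕ.+ i) *M A j)))

  rhsCoeff : ∀ {l} → (ℕ → Mat l) → ℕ → ℕ → Mat l
  rhsCoeff A n zero    = A n
  rhsCoeff A n (suc N) = 0M

  -- ∏_{i=0}^{n} (iα + A_1)   (the factors commute)
  prodA : ∀ {l} → Mat l → Carrier → ℕ → Mat l
  prodA A₁ α zero    = A₁
  prodA A₁ α (suc n) = prodA A₁ α n *M (((fromℕ (suc n) * α) ·M IM) +M A₁)

  -- R is ℤ-torsion-free (as O_K is)
  TorsionFree : Set (c Level.⊔ ℓ)
  TorsionFree = ∀ (m : ℕ) (x : Carrier) → fromℕ (suc m) * x ≈ 0# → x ≈ 0#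

{-# OPTIONS --safe #-}
-- Write E = Σ_j A_j X^{[j]} and G_n = Σ_i (-1)^i A_{n+i} (1 - αX)^{-n-i} X^{[i]}, so that (1) says G_n E = A_n.
-- The X^{[1]}-coefficient of G_n E is A_n A_1 + nα A_n - A_{n+1}, so (1) forces A_{n+1} = A_n (nα + A_1),
-- which unfolds to (2). Conversely, under this recurrence the coefficients of E are the rising products of the
-- factors tα + A_1, the coefficients of G_n are A_n times the rising products of the factors tα - A_1 (an
-- induction along Pascal's rule), and the binomial convolution of these two kinds of rising products is the
-- coefficient sequence of (1 - αX)^{-(d+e)}; for d = e = 0 this is the constant series 1.
module Submission where

open import Defs
open import Level using (Level; _⊔_) renaming (suc to lsuc)
open import Algebra.Bundles using (CommutativeMonoid; CommutativeRing; SemiringWithoutAnnihilatingZero)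
open import Data.Nat as ℕ using (ℕ; zero; suc; _∸_; _≤_; _<_; z≤n; s≤s; _!)
import Data.Nat.Properties as ℕ
open import Data.Nat.Combinatorics
  using (_C_; nCk+nC[k+1]≡[n+1]C[k+1]; k>n⇒nCk≡0; nCk≡nC[n∸k]; nCn≡1; nC1≡n)
open import Data.Nat.Tactic.RingSolver using (solve-∀)
open import Data.Product using (_×_; _,_)
open import Data.Empty using (⊥-elim)
open import Relation.Binary.PropositionalEquality as ≡ using (_≡_)

nC0≡1 : ∀ n → n C 0 ≡ 1
nC0≡1 n = ≡.trans (nCk≡nC[n∸k] {0} {n} z≤n) (nCn≡1 n)

[1+k]*nC[1+k]+k*nCk≡n*nCk : ∀ n k → suc k ℕ.* (n C suc k) ℕ.+ k ℕ.* (n C k) ≡ n ℕ.* (n C k)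
[1+k]*nC[1+k]+k*nCk≡n*nCk zero zero = ≡.refl
[1+k]*nC[1+k]+k*nCk≡n*nCk zero (suc k)
  rewrite k>n⇒nCk≡0 {0} {suc (suc k)} (s≤s z≤n) | k>n⇒nCk≡0 {0} {suc k} (s≤s z≤n) =
  ≡.cong₂ ℕ._+_ (ℕ.*-zeroʳ (suc (suc k))) (ℕ.*-zeroʳ (suc k))
[1+k]*nC[1+k]+k*nCk≡n*nCk (suc n) zero
  rewrite nC1≡n (suc n) | nC0≡1 (suc n) = ≡.trans (ℕ.+-identityʳ _) (ℕ.*-comm 1 (suc n))
[1+k]*nC[1+k]+k*nCk≡n*nCk (suc n) (suc k) = begin
    suc (suc k) ℕ.* (suc n C suc (suc k)) ℕ.+ suc k ℕ.* (suc n C suc k)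
  ≡⟨ ≡.cong₂ (λ u v → suc (suc k) ℕ.* u ℕ.+ suc k ℕ.* v)
       (≡.sym (nCk+nC[k+1]≡[n+1]C[k+1] n (suc k))) (≡.sym (nCk+nC[k+1]≡[n+1]C[k+1] n k)) ⟩
    suc (suc k) ℕ.* (b ℕ.+ c) ℕ.+ suc k ℕ.* (a ℕ.+ b)
  ≡⟨ regroup k a b c ⟩
    (suc (suc k) ℕ.* c ℕ.+ suc k ℕ.* b) ℕ.+ (suc k ℕ.* b ℕ.+ k ℕ.* a) ℕ.+ (a ℕ.+ b)
  ≡⟨ ≡.cong₂ (λ u v → u ℕ.+ v ℕ.+ (a ℕ.+ b))
       ([1+k]*nC[1+k]+k*nCk≡n*nCk n (suc k)) ([1+k]*nC[1+k]+k*nCk≡n*nCk n k) ⟩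
    n ℕ.* b ℕ.+ n ℕ.* a ℕ.+ (a ℕ.+ b)
  ≡⟨ collect n a b ⟩
    suc n ℕ.* (a ℕ.+ b)
  ≡⟨ ≡.cong (suc n ℕ.*_) (nCk+nC[k+1]≡[n+1]C[k+1] n k) ⟩
    suc n ℕ.* (suc n C suc k) ∎
  where
  open ≡.≡-Reasoning
  a = n C k
  b = n C suc k
  c = n C suc (suc k)
  regroup : ∀ k a b c → suc (suc k) ℕ.* (b ℕ.+ c) ℕ.+ suc k ℕ.* (a ℕ.+ b)
          ≡ (suc (suc k) ℕ.* c ℕ.+ suc k ℕ.* b) ℕ.+ (suc k ℕ.* b ℕ.+ k ℕ.* a) ℕ.+ (a ℕ.+ b)
  regroup = solve-∀
  collect : ∀ n a b → n ℕ.* b ℕ.+ n ℕ.* a ℕ.+ (a ℕ.+ b) ≡ suc n ℕ.* (a ℕ.+ b)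
  collect = solve-∀

[1+k]*[m+k]C[1+k]≡m*[m+k]Ck : ∀ m k → suc k ℕ.* ((m ℕ.+ k) C suc k) ≡ m ℕ.* ((m ℕ.+ k) C k)
[1+k]*[m+k]C[1+k]≡m*[m+k]Ck m k = ℕ.+-cancelʳ-≡ _ _ _
  (≡.trans ([1+k]*nC[1+k]+k*nCk≡n*nCk (m ℕ.+ k) k) (ℕ.*-distribʳ-+ ((m ℕ.+ k) C k) m k))

[m+k]C[1+k]*[1+k]!≡m*[m+k]Ck*k! : ∀ m k →
  (((m ℕ.+ suc k) ∸ 1) C suc k) ℕ.* suc k ! ≡ m ℕ.* ((((suc m ℕ.+ k) ∸ 1) C k) ℕ.* k !)
[m+k]C[1+k]*[1+k]!≡m*[m+k]Ck*k! m k = begin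
    (((m ℕ.+ suc k) ∸ 1) C suc k) ℕ.* suc k !
  ≡⟨ ≡.cong (λ t → ((t ∸ 1) C suc k) ℕ.* suc k !) (ℕ.+-suc m k) ⟩
    ((m ℕ.+ k) C suc k) ℕ.* (suc k ℕ.* k !)
  ≡⟨ ≡.sym (ℕ.*-assoc ((m ℕ.+ k) C suc k) (suc k) (k !)) ⟩
    ((m ℕ.+ k) C suc k) ℕ.* suc k ℕ.* k !
  ≡⟨ ≡.cong (ℕ._* k !) (≡.trans (ℕ.*-comm ((m ℕ.+ k) C suc k) (suc k)) ([1+k]*[m+k]C[1+k]≡m*[m+k]Ck m k)) ⟩
    m ℕ.* ((m ℕ.+ k) C k) ℕ.* k !
  ≡⟨ ℕ.*-assoc m ((m ℕ.+ k) C k) (k !) ⟩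
    m ℕ.* (((m ℕ.+ k) C k) ℕ.* k !) ∎
  where open ≡.≡-Reasoning

module Scalars {c ℓ : Level} (R : CommutativeRing c ℓ) where
  open CommutativeRing R
  open import Algebra.Properties.Semiring.Mult semiring using (×-homo-+; ×1-homo-*)
    renaming (_×_ to _×ₙ_)
  open import Relation.Binary.Reasoning.Setoid setoid
  open import Data.Maybe using (nothing)
  open import Tactic.RingSolver.Core.AlmostCommutativeRing using (fromCommutativeRing)
  open import Tactic.RingSolver.NonReflective (fromCommutativeRing R (λ _ → nothing))

  fromℕ≡×1 : ∀ n → fromℕ R n ≡ n ×ₙ 1#
  fromℕ≡×1 zero    = ≡.refl
  fromℕ≡×1 (suc n) = ≡.cong (1# +_) (fromℕ≡×1 n)

  fromℕ-cong : ∀ {m n} → m ≡ n → fromℕ R m ≈ fromℕ R n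
  fromℕ-cong m≡n = reflexive (≡.cong (fromℕ R) m≡n)

  fromℕ-1 : fromℕ R 1 ≈ 1#
  fromℕ-1 = +-identityʳ 1#

  fromℕ-homo-+ : ∀ m n → fromℕ R (m ℕ.+ n) ≈ fromℕ R m + fromℕ R n
  fromℕ-homo-+ m n = begin
    fromℕ R (m ℕ.+ n)          ≡⟨ fromℕ≡×1 (m ℕ.+ n) ⟩
    (m ℕ.+ n) ×ₙ 1#            ≈⟨ ×-homo-+ 1# m n ⟩
    m ×ₙ 1# + n ×ₙ 1#          ≡⟨ ≡.sym (≡.cong₂ _+_ (fromℕ≡×1 m) (fromℕ≡×1 n)) ⟩
    fromℕ R m + fromℕ R n      ∎

  fromℕ-homo-* : ∀ m n → fromℕ R (m ℕ.* n) ≈ fromℕ R m * fromℕ R n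
  fromℕ-homo-* m n = begin
    fromℕ R (m ℕ.* n)          ≡⟨ fromℕ≡×1 (m ℕ.* n) ⟩
    (m ℕ.* n) ×ₙ 1#            ≈⟨ ×1-homo-* m n ⟩
    m ×ₙ 1# * n ×ₙ 1#          ≡⟨ ≡.sym (≡.cong₂ _*_ (fromℕ≡×1 m) (fromℕ≡×1 n)) ⟩
    fromℕ R m * fromℕ R n      ∎

  invPow≈fromℕ*pow : ∀ α m k → invPow R α m k ≈ fromℕ R ((((m ℕ.+ k) ∸ 1) C k) ℕ.* k !) * pow R α k
  invPow≈fromℕ*pow α m k = begin
    fromℕ R b * (pow R α k * fromℕ R (k !))       ≈⟨ solve 3 (λ x y z → x ⊗ (y ⊗ z) ⊜ (x ⊗ z) ⊗ y)
                                                       refl (fromℕ R b) (pow R α k) (fromℕ R (k !)) ⟩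
    fromℕ R b * fromℕ R (k !) * pow R α k         ≈⟨ *-congʳ (sym (fromℕ-homo-* b (k !))) ⟩
    fromℕ R (b ℕ.* k !) * pow R α k               ∎
    where b = ((m ℕ.+ k) ∸ 1) C k

  invPow-zero : ∀ α m → invPow R α m 0 ≈ 1#
  invPow-zero α m = begin
    fromℕ R (((m ℕ.+ 0) ∸ 1) C 0) * (1# * fromℕ R 1)  ≈⟨ *-cong (fromℕ-cong (nC0≡1 (m ℕ.+ 0 ∸ 1))) (*-identityˡ _) ⟩
    fromℕ R 1 * fromℕ R 1                             ≈⟨ *-cong fromℕ-1 fromℕ-1 ⟩
    1# * 1#                                           ≈⟨ *-identityˡ 1# ⟩
    1#                                                ∎

  invPow-0-suc : ∀ α k → invPow R α 0 (suc k) ≈ 0#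
  invPow-0-suc α k = trans (*-congʳ (fromℕ-cong (k>n⇒nCk≡0 (ℕ.n<1+n k)))) (zeroˡ _)

  invPow-suc : ∀ α m k → invPow R α m (suc k) ≈ (fromℕ R m * α) * invPow R α (suc m) k
  invPow-suc α m k = begin
    invPow R α m (suc k)                    ≈⟨ invPow≈fromℕ*pow α m (suc k) ⟩
    fromℕ R ((((m ℕ.+ suc k) ∸ 1) C suc k) ℕ.* suc k !) * (α * pow R α k)
                                            ≈⟨ *-congʳ (fromℕ-cong ([m+k]C[1+k]*[1+k]!≡m*[m+k]Ck*k! m k)) ⟩
    fromℕ R (m ℕ.* b) * (α * pow R α k)     ≈⟨ *-congʳ (fromℕ-homo-* m b) ⟩
    fromℕ R m * fromℕ R b * (α * pow R α k) ≈⟨ solve 4 (λ x y a p → x ⊗ y ⊗ (a ⊗ p) ⊜ x ⊗ a ⊗ (y ⊗ p))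
                                                 refl (fromℕ R m) (fromℕ R b) α (pow R α k) ⟩
    fromℕ R m * α * (fromℕ R b * pow R α k) ≈⟨ *-congˡ (sym (invPow≈fromℕ*pow α (suc m) k)) ⟩
    fromℕ R m * α * invPow R α (suc m) k    ∎
    where b = (((suc m ℕ.+ k) ∸ 1) C k) ℕ.* k !

record Algebra {c ℓ : Level} (R : CommutativeRing c ℓ) (a ℓa : Level) : Set (c ⊔ ℓ ⊔ lsuc (a ⊔ ℓa)) where
  private module R = CommutativeRing R
  field
    semiring : SemiringWithoutAnnihilatingZero a ℓa
  open SemiringWithoutAnnihilatingZero semiring public
  infixr 7 _·_
  field
    _·_        : R.Carrier → Carrier → Carrier
    ·-cong     : ∀ {r s x y} → r R.≈ s → x ≈ y → r · x ≈ s · y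
    ·-distribˡ : ∀ r x y → r · (x + y) ≈ r · x + r · y
    ·-distribʳ : ∀ r s x → (r R.+ s) · x ≈ r · x + s · x
    ·-assoc    : ∀ r s x → (r R.* s) · x ≈ r · (s · x)
    ·-identity : ∀ x → R.1# · x ≈ x
    ·-zero     : ∀ x → R.0# · x ≈ 0#
    *-·-assocˡ : ∀ r x y → (r · x) * y ≈ r · (x * y)
    *-·-assocʳ : ∀ r x y → x * (r · y) ≈ r · (x * y)
    -- Σ N f = f 0 + ⋯ + f N is a field so that it can be sumToM for matrices, the sum
    -- in terms of which lhsCoeff is written.
    Σ     : ℕ → (ℕ → Carrier) → Carrier
    Σ-zero : ∀ f → Σ 0 f ≈ f 0
    Σ-suc  : ∀ N f → Σ (suc N) f ≈ Σ N f + f (suc N)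

module _ {c ℓ : Level} (R : CommutativeRing c ℓ) where
  open CommutativeRing R
  open import Algebra.Properties.Semiring.Sum semiring
    using (sum; sum-cong-≋; ∑-comm; ∑-distrib-+; *-distribˡ-sum; *-distribʳ-sum)
  open import Algebra.Properties.CommutativeSemigroup *-commutativeSemigroup using (x∙yz≈y∙xz)
  open import Relation.Binary.Reasoning.Setoid setoid
  import Algebra.Construct.Pointwise as Pointwise
  open import Data.Fin as F using (Fin)
  open import Data.Fin.Properties using (suc-injective)
  open import Relation.Nullary using (Dec; yes; no; ¬_)

  sumFin≡sum : ∀ {n} (f : Fin n → Carrier) → sumFin R f ≡ sum f
  sumFin≡sum {zero}  f = ≡.refl
  sumFin≡sum {suc n} f = ≡.cong (f F.zero +_) (sumFin≡sum (λ i → f (F.suc i)))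

  sumFin-cong : ∀ {n} (f g : Fin n → Carrier) → (∀ k → f k ≈ g k) → sumFin R f ≈ sumFin R g
  sumFin-cong f g f≈g = begin
    sumFin R f ≡⟨ sumFin≡sum f ⟩ sum f ≈⟨ sum-cong-≋ f≈g ⟩ sum g ≡⟨ sumFin≡sum g ⟨ sumFin R g ∎

  sumFin-zeros : ∀ {n} (f : Fin n → Carrier) → (∀ k → f k ≈ 0#) → sumFin R f ≈ 0#
  sumFin-zeros {zero}  _ _   = refl
  sumFin-zeros {suc n} f f≈0 =
    trans (+-cong (f≈0 F.zero) (sumFin-zeros (λ k → f (F.suc k)) (λ k → f≈0 (F.suc k)))) (+-identityʳ 0#)

  IM-diag : ∀ {n} (i : Fin n) → IM R i i ≈ 1#
  IM-diag i with i F.≟ i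
  ... | yes _  = refl
  ... | no i≢i = ⊥-elim (i≢i ≡.refl)

  IM-offDiag : ∀ {n} (i j : Fin n) → ¬ i ≡ j → IM R i j ≈ 0#
  IM-offDiag i j i≢j with i F.≟ j
  ... | yes i≡j = ⊥-elim (i≢j i≡j)
  ... | no _    = refl

  IM-suc : ∀ {n} (i j : Fin n) → IM R (F.suc i) (F.suc j) ≈ IM R i j
  IM-suc i j = by-cases (i F.≟ j)
    where
    by-cases : Dec (i ≡ j) → IM R (F.suc i) (F.suc j) ≈ IM R i j
    by-cases (yes ≡.refl) = trans (IM-diag (F.suc i)) (sym (IM-diag i))
    by-cases (no i≢j)     = trans (IM-offDiag _ _ (λ e → i≢j (suc-injective e))) (sym (IM-offDiag i j i≢j))

  IM-sym : ∀ {n} (i j : Fin n) → IM R i j ≈ IM R j i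
  IM-sym i j = by-cases (i F.≟ j)
    where
    by-cases : Dec (i ≡ j) → IM R i j ≈ IM R j i
    by-cases (yes ≡.refl) = refl
    by-cases (no i≢j)     = trans (IM-offDiag i j i≢j) (sym (IM-offDiag j i (λ j≡i → i≢j (≡.sym j≡i))))

  sumFin-IMˡ : ∀ {n} (i : Fin n) (f : Fin n → Carrier) → sumFin R (λ k → IM R i k * f k) ≈ f i
  sumFin-IMˡ {suc n} F.zero f = begin
    IM R {suc n} F.zero F.zero * f F.zero + sumFin R (λ k → IM R F.zero (F.suc k) * f (F.suc k))
      ≈⟨ +-cong (trans (*-congʳ (IM-diag {suc n} F.zero)) (*-identityˡ _))
                (sumFin-zeros (λ k → IM R F.zero (F.suc k) * f (F.suc k))
                              (λ k → trans (*-congʳ (IM-offDiag F.zero (F.suc k) λ ())) (zeroˡ _))) ⟩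
    f F.zero + 0#  ≈⟨ +-identityʳ _ ⟩
    f F.zero       ∎
  sumFin-IMˡ {suc n} (F.suc i) f = begin
    IM R (F.suc i) F.zero * f F.zero + sumFin R (λ k → IM R (F.suc i) (F.suc k) * f (F.suc k))
      ≈⟨ +-cong (trans (*-congʳ (IM-offDiag (F.suc i) F.zero λ ())) (zeroˡ _))
                (sumFin-cong _ _ (λ k → *-congʳ (IM-suc i k))) ⟩
    0# + sumFin R (λ k → IM R i k * f (F.suc k))  ≈⟨ +-identityˡ _ ⟩
    sumFin R (λ k → IM R i k * f (F.suc k))       ≈⟨ sumFin-IMˡ i (λ k → f (F.suc k)) ⟩
    f (F.suc i)                                   ∎

  sumFin-IMʳ : ∀ {n} (j : Fin n) (f : Fin n → Carrier) → sumFin R (λ k → f k * IM R k j) ≈ f j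
  sumFin-IMʳ j f = trans (sumFin-cong _ _ (λ k → trans (*-comm _ _) (*-congʳ (IM-sym k j)))) (sumFin-IMˡ j f)

  sumFin-distrib-+ : ∀ {n} (f g : Fin n → Carrier) →
                     sumFin R (λ k → f k + g k) ≈ sumFin R f + sumFin R g
  sumFin-distrib-+ f g = begin
    sumFin R (λ k → f k + g k) ≡⟨ sumFin≡sum (λ k → f k + g k) ⟩
    sum (λ k → f k + g k)      ≈⟨ ∑-distrib-+ f g ⟩
    sum f + sum g              ≡⟨ ≡.cong₂ _+_ (sumFin≡sum f) (sumFin≡sum g) ⟨
    sumFin R f + sumFin R g    ∎

  *-distribˡ-sumFin : ∀ {n} x (f : Fin n → Carrier) → x * sumFin R f ≈ sumFin R (λ k → x * f k)
  *-distribˡ-sumFin x f = begin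
    x * sumFin R f           ≡⟨ ≡.cong (x *_) (sumFin≡sum f) ⟩
    x * sum f                ≈⟨ *-distribˡ-sum x f ⟩
    sum (λ k → x * f k)      ≡⟨ sumFin≡sum (λ k → x * f k) ⟨
    sumFin R (λ k → x * f k) ∎

  *-distribʳ-sumFin : ∀ {n} x (f : Fin n → Carrier) → sumFin R f * x ≈ sumFin R (λ k → f k * x)
  *-distribʳ-sumFin x f = begin
    sumFin R f * x           ≡⟨ ≡.cong (_* x) (sumFin≡sum f) ⟩
    sum f * x                ≈⟨ *-distribʳ-sum x f ⟩
    sum (λ k → f k * x)      ≡⟨ sumFin≡sum (λ k → f k * x) ⟨
    sumFin R (λ k → f k * x) ∎

  sumFin-comm : ∀ {m n} (f : Fin m → Fin n → Carrier) →
                sumFin R (λ i → sumFin R (f i)) ≈ sumFin R (λ j → sumFin R (λ i → f i j))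
  sumFin-comm f = begin
    sumFin R (λ i → sumFin R (f i))           ≈⟨ sumFin-cong _ _ (λ i → reflexive (sumFin≡sum (f i))) ⟩
    sumFin R (λ i → sum (f i))                ≡⟨ sumFin≡sum (λ i → sum (f i)) ⟩
    sum (λ i → sum (f i))                     ≈⟨ ∑-comm f ⟩
    sum (λ j → sum (λ i → f i j))             ≡⟨ sumFin≡sum (λ j → sum (λ i → f i j)) ⟨
    sumFin R (λ j → sum (λ i → f i j))        ≈⟨ sumFin-cong _ _ (λ j → reflexive (sumFin≡sum (λ i → f i j))) ⟨
    sumFin R (λ j → sumFin R (λ i → f i j))   ∎

  *M-assoc : ∀ {l} (X Y Z : Mat R l) → _≈M_ R (_*M_ R (_*M_ R X Y) Z) (_*M_ R X (_*M_ R Y Z))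
  *M-assoc X Y Z i j = begin
    sumFin R (λ k → sumFin R (λ m → X i m * Y m k) * Z k j)
      ≈⟨ sumFin-cong _ _ (λ k → *-distribʳ-sumFin (Z k j) (λ m → X i m * Y m k)) ⟩
    sumFin R (λ k → sumFin R (λ m → X i m * Y m k * Z k j))
      ≈⟨ sumFin-comm (λ k m → X i m * Y m k * Z k j) ⟩
    sumFin R (λ m → sumFin R (λ k → X i m * Y m k * Z k j))
      ≈⟨ sumFin-cong _ _ (λ m → trans (sumFin-cong _ _ (λ k → *-assoc (X i m) (Y m k) (Z k j)))
                                       (sym (*-distribˡ-sumFin (X i m) (λ k → Y m k * Z k j)))) ⟩
    sumFin R (λ m → X i m * sumFin R (λ k → Y m k * Z k j)) ∎

  matrixAlgebra : ℕ → Algebra R c ℓ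
  matrixAlgebra l = record
    { semiring = record
      { isSemiringWithoutAnnihilatingZero = record
        { +-isCommutativeMonoid =
            Pointwise.isCommutativeMonoid (Fin l) (Pointwise.isCommutativeMonoid (Fin l) +-isCommutativeMonoid)
        ; *-cong   = λ X≈Y U≈V i j → sumFin-cong _ _ (λ k → *-cong (X≈Y i k) (U≈V k j))
        ; *-assoc  = *M-assoc
        ; *-identity = (λ X i j → sumFin-IMˡ i (λ k → X k j)) , (λ X i j → sumFin-IMʳ j (X i))
        ; distrib  = (λ X Y Z i j → trans (sumFin-cong _ _ (λ k → distribˡ (X i k) (Y k j) (Z k j)))
                                          (sumFin-distrib-+ (λ k → X i k * Y k j) (λ k → X i k * Z k j)))
                   , (λ X Y Z i j → trans (sumFin-cong _ _ (λ k → distribʳ (X k j) (Y i k) (Z i k)))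
                                          (sumFin-distrib-+ (λ k → Y i k * X k j) (λ k → Z i k * X k j)))
        }
      }
    ; _·_        = _·M_ R
    ; ·-cong     = λ r≈s X≈Y i j → *-cong r≈s (X≈Y i j)
    ; ·-distribˡ = λ r X Y i j → distribˡ r _ _
    ; ·-distribʳ = λ r s X i j → distribʳ _ r s
    ; ·-assoc    = λ r s X i j → *-assoc r s _
    ; ·-identity = λ X i j → *-identityˡ _
    ; ·-zero     = λ X i j → zeroˡ _
    ; *-·-assocˡ = λ r X Y i j → trans (sumFin-cong _ _ (λ k → *-assoc r (X i k) (Y k j)))
                                       (sym (*-distribˡ-sumFin r (λ k → X i k * Y k j)))
    ; *-·-assocʳ = λ r X Y i j → trans (sumFin-cong _ _ (λ k → x∙yz≈y∙xz (X i k) r (Y k j)))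
                                       (sym (*-distribˡ-sumFin r (λ k → X i k * Y k j)))
    ; Σ          = sumToM R
    ; Σ-zero     = λ _ _ _ → refl
    ; Σ-suc      = λ _ _ _ _ → refl
    }

module FiniteSums {a ℓa : Level} (M : CommutativeMonoid a ℓa)
  (Σ : ℕ → (ℕ → CommutativeMonoid.Carrier M) → CommutativeMonoid.Carrier M)
  (Σ-zero : ∀ f → CommutativeMonoid._≈_ M (Σ 0 f) (f 0))
  (Σ-suc : ∀ N f → CommutativeMonoid._≈_ M (Σ (suc N) f) (CommutativeMonoid._∙_ M (Σ N f) (f (suc N)))) where

  open CommutativeMonoid M

  open import Relation.Binary.Reasoning.Setoid setoid
  open import Algebra.Properties.CommutativeSemigroup commutativeSemigroup using (interchange)
  open import Relation.Nullary using (yes; no; ¬_)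
  open import Data.Sum using (inj₁; inj₂)

  Σ-cong : ∀ N {f g : ℕ → Carrier} → (∀ i → i ≤ N → f i ≈ g i) → Σ N f ≈ Σ N g
  Σ-cong zero    {f} {g} f≈g = trans (Σ-zero f) (trans (f≈g 0 z≤n) (sym (Σ-zero g)))
  Σ-cong (suc N) {f} {g} f≈g = begin
    Σ (suc N) f          ≈⟨ Σ-suc N f ⟩
    Σ N f ∙ f (suc N)    ≈⟨ ∙-cong (Σ-cong N (λ i i≤N → f≈g i (ℕ.m≤n⇒m≤1+n i≤N))) (f≈g (suc N) ℕ.≤-refl) ⟩
    Σ N g ∙ g (suc N)    ≈⟨ Σ-suc N g ⟨
    Σ (suc N) g          ∎

  Σ-distrib : ∀ N (f g : ℕ → Carrier) → Σ N (λ i → f i ∙ g i) ≈ Σ N f ∙ Σ N g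
  Σ-distrib zero    f g = trans (Σ-zero _) (sym (∙-cong (Σ-zero f) (Σ-zero g)))
  Σ-distrib (suc N) f g = begin
    Σ (suc N) (λ i → f i ∙ g i)                     ≈⟨ Σ-suc N _ ⟩
    Σ N (λ i → f i ∙ g i) ∙ (f (suc N) ∙ g (suc N)) ≈⟨ ∙-congʳ (Σ-distrib N f g) ⟩
    (Σ N f ∙ Σ N g) ∙ (f (suc N) ∙ g (suc N))       ≈⟨ interchange _ _ _ _ ⟩
    (Σ N f ∙ f (suc N)) ∙ (Σ N g ∙ g (suc N))       ≈⟨ ∙-cong (Σ-suc N f) (Σ-suc N g) ⟨
    Σ (suc N) f ∙ Σ (suc N) g                       ∎

  Σ-homo : (h : Carrier → Carrier) → (∀ {x y} → x ≈ y → h x ≈ h y) → (∀ x y → h (x ∙ y) ≈ h x ∙ h y) →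
           ∀ N f → h (Σ N f) ≈ Σ N (λ i → h (f i))
  Σ-homo h h-cong h-∙ zero    f = trans (h-cong (Σ-zero f)) (sym (Σ-zero _))
  Σ-homo h h-cong h-∙ (suc N) f = begin
    h (Σ (suc N) f)                     ≈⟨ h-cong (Σ-suc N f) ⟩
    h (Σ N f ∙ f (suc N))               ≈⟨ h-∙ _ _ ⟩
    h (Σ N f) ∙ h (f (suc N))           ≈⟨ ∙-congʳ (Σ-homo h h-cong h-∙ N f) ⟩
    Σ N (λ i → h (f i)) ∙ h (f (suc N)) ≈⟨ Σ-suc N _ ⟨
    Σ (suc N) (λ i → h (f i))           ∎

  Σ-shift : ∀ N f → Σ (suc N) f ≈ f 0 ∙ Σ N (λ i → f (suc i))
  Σ-shift zero    f = trans (Σ-suc 0 f) (∙-cong (Σ-zero f) (sym (Σ-zero _)))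
  Σ-shift (suc N) f = begin
    Σ (suc (suc N)) f                                 ≈⟨ Σ-suc (suc N) f ⟩
    Σ (suc N) f ∙ f (suc (suc N))                     ≈⟨ ∙-congʳ (Σ-shift N f) ⟩
    (f 0 ∙ Σ N (λ i → f (suc i))) ∙ f (suc (suc N))   ≈⟨ assoc _ _ _ ⟩
    f 0 ∙ (Σ N (λ i → f (suc i)) ∙ f (suc (suc N)))   ≈⟨ ∙-congˡ (Σ-suc N _) ⟨
    f 0 ∙ Σ (suc N) (λ i → f (suc i))                 ∎

  Σ-zeros : ∀ N {f : ℕ → Carrier} → (∀ i → i ≤ N → f i ≈ ε) → Σ N f ≈ ε
  Σ-zeros N {f} f≈ε = trans (Σ-cong N f≈ε) (Σ-const N)
    where
    Σ-const : ∀ N → Σ N (λ _ → ε) ≈ ε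
    Σ-const zero    = Σ-zero _
    Σ-const (suc N) = trans (Σ-suc N _) (trans (∙-congʳ (Σ-const N)) (identityˡ ε))

  Σ-trunc : ∀ {M N} {f : ℕ → Carrier} → M ≤ N → (∀ i → M < i → i ≤ N → f i ≈ ε) → Σ N f ≈ Σ M f
  Σ-trunc {M} {N} {f} M≤N f≈ε with ℕ.m≤n⇒m<n∨m≡n M≤N
  ... | inj₂ ≡.refl = refl
  ... | inj₁ (s≤s {n = N′} M≤N′) = begin
    Σ (suc N′) f       ≈⟨ Σ-suc N′ f ⟩
    Σ N′ f ∙ f (suc N′) ≈⟨ ∙-cong (Σ-trunc M≤N′ (λ i M<i i≤N′ → f≈ε i M<i (ℕ.m≤n⇒m≤1+n i≤N′)))
                                  (f≈ε (suc N′) (s≤s M≤N′) ℕ.≤-refl) ⟩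
    Σ M f ∙ ε          ≈⟨ identityʳ _ ⟩
    Σ M f              ∎

  Σ-single : ∀ {a N} {f : ℕ → Carrier} → a ≤ N → (∀ i → i ≤ N → ¬ i ≡ a → f i ≈ ε) → Σ N f ≈ f a
  Σ-single {a} {zero}  {f} z≤n f≈ε = Σ-zero f
  Σ-single {a} {suc N} {f} a≤N f≈ε with a ℕ.≟ suc N
  ... | yes ≡.refl = begin
    Σ (suc N) f         ≈⟨ Σ-suc N f ⟩
    Σ N f ∙ f (suc N)   ≈⟨ ∙-congʳ (Σ-zeros N (λ i i≤N → f≈ε i (ℕ.m≤n⇒m≤1+n i≤N) (ℕ.<⇒≢ (s≤s i≤N)))) ⟩
    ε ∙ f (suc N)       ≈⟨ identityˡ _ ⟩
    f (suc N)           ∎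
  ... | no a≢1+N = trans (Σ-suc N f)
        (trans (∙-cong (Σ-single (ℕ.s≤s⁻¹ (ℕ.≤∧≢⇒< a≤N a≢1+N)) (λ i i≤N → f≈ε i (ℕ.m≤n⇒m≤1+n i≤N)))
                       (f≈ε (suc N) ℕ.≤-refl (λ 1+N≡a → a≢1+N (≡.sym 1+N≡a))))
               (identityʳ _))

  Σ-comm : ∀ N K (f : ℕ → ℕ → Carrier) → Σ N (λ i → Σ K (f i)) ≈ Σ K (λ j → Σ N (λ i → f i j))
  Σ-comm zero    K f = trans (Σ-zero _) (Σ-cong K (λ j _ → sym (Σ-zero _)))
  Σ-comm (suc N) K f = begin
    Σ (suc N) (λ i → Σ K (f i))                              ≈⟨ Σ-suc N _ ⟩
    Σ N (λ i → Σ K (f i)) ∙ Σ K (f (suc N))                  ≈⟨ ∙-congʳ (Σ-comm N K f) ⟩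
    Σ K (λ j → Σ N (λ i → f i j)) ∙ Σ K (f (suc N))          ≈⟨ Σ-distrib K _ _ ⟨
    Σ K (λ j → Σ N (λ i → f i j) ∙ f (suc N) j)              ≈⟨ Σ-cong K (λ j _ → Σ-suc N _) ⟨
    Σ K (λ j → Σ (suc N) (λ i → f i j))                      ∎

module AlgebraProperties {c ℓ a ℓa : Level} {R : CommutativeRing c ℓ} (𝔸 : Algebra R a ℓa) where
  private module R = CommutativeRing R
  open Algebra 𝔸 public
  open import Relation.Binary.Reasoning.Setoid setoid
  open Scalars R using (fromℕ-cong; fromℕ-1; fromℕ-homo-+)
  open import Algebra.Properties.CommutativeSemigroup +-commutativeSemigroup using (x∙yz≈y∙xz)
  open FiniteSums +-commutativeMonoid Σ Σ-zero Σ-suc public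

  ι : R.Carrier → Carrier
  ι r = r · 1#

  ι-*ˡ : ∀ r x → ι r * x ≈ r · x
  ι-*ˡ r x = trans (*-·-assocˡ r 1# x) (·-cong R.refl (*-identityˡ x))

  ι-*ʳ : ∀ r x → x * ι r ≈ r · x
  ι-*ʳ r x = trans (*-·-assocʳ r x 1#) (·-cong R.refl (*-identityʳ x))

  ι-homo-* : ∀ r s → ι (r R.* s) ≈ ι r * ι s
  ι-homo-* r s = trans (·-assoc r s 1#) (sym (ι-*ˡ r (ι s)))

  Commute : Carrier → Carrier → Set ℓa
  Commute x y = x * y ≈ y * x

  ι-commute : ∀ r x → Commute (ι r) x
  ι-commute r x = trans (ι-*ˡ r x) (sym (ι-*ʳ r x))

  commute-+ : ∀ {x y z} → Commute x y → Commute x z → Commute x (y + z)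
  commute-+ {x} {y} {z} xy≈yx xz≈zx = trans (distribˡ x y z) (trans (+-cong xy≈yx xz≈zx) (sym (distribʳ x y z)))

  commute-· : ∀ {x y} r → Commute x y → Commute x (r · y)
  commute-· {x} {y} r xy≈yx = trans (*-·-assocʳ r x y) (trans (·-cong R.refl xy≈yx) (sym (*-·-assocˡ r y x)))

  commute-* : ∀ {x y z} → Commute x y → Commute x z → Commute x (y * z)
  commute-* {x} {y} {z} xy≈yx xz≈zx = begin
    x * (y * z)   ≈⟨ *-assoc x y z ⟨
    (x * y) * z   ≈⟨ *-congʳ xy≈yx ⟩
    (y * x) * z   ≈⟨ *-assoc y x z ⟩
    y * (x * z)   ≈⟨ *-congˡ xz≈zx ⟩
    y * (z * x)   ≈⟨ *-assoc y z x ⟨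
    (y * z) * x   ∎

  infixl 6 _−_
  _−_ : Carrier → Carrier → Carrier
  x − y = x + (R.- R.1#) · y

  x−x≈0 : ∀ x → x − x ≈ 0#
  x−x≈0 x = begin
    x + (R.- R.1#) · x               ≈⟨ +-congʳ (·-identity x) ⟨
    R.1# · x + (R.- R.1#) · x        ≈⟨ ·-distribʳ R.1# (R.- R.1#) x ⟨
    (R.1# R.+ R.- R.1#) · x          ≈⟨ ·-cong (R.-‿inverseʳ R.1#) refl ⟩
    R.0# · x                         ≈⟨ ·-zero x ⟩
    0#                               ∎

  Σ-· : ∀ r N f → r · Σ N f ≈ Σ N (λ i → r · f i)
  Σ-· r = Σ-homo (r ·_) (·-cong R.refl) (·-distribˡ r)

  Σ-*ʳ : ∀ x N f → Σ N f * x ≈ Σ N (λ i → f i * x)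
  Σ-*ʳ x = Σ-homo (_* x) *-congʳ (λ y z → distribʳ x y z)

  Σ-*ˡ : ∀ x N f → x * Σ N f ≈ Σ N (λ i → x * f i)
  Σ-*ˡ x = Σ-homo (x *_) *-congˡ (distribˡ x)

  nC0·x≈x : ∀ n x → fromℕ R (n C 0) · x ≈ x
  nC0·x≈x n x = trans (·-cong (R.trans (fromℕ-cong (nC0≡1 n)) fromℕ-1) refl) (·-identity x)

  opaque
    binomialSum : ℕ → (ℕ → ℕ → Carrier) → Carrier
    binomialSum N h = Σ N (λ i → fromℕ R (N C i) · h i (N ∸ i))

    binomialSum-unfold : ∀ N h → binomialSum N h ≈ Σ N (λ i → fromℕ R (N C i) · h i (N ∸ i))
    binomialSum-unfold N h = refl

    binomialSum-zero : ∀ h → binomialSum 0 h ≈ h 0 0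
    binomialSum-zero h = trans (Σ-zero _) (nC0·x≈x 0 (h 0 0))

    binomialSum-cong : ∀ N {h h′ : ℕ → ℕ → Carrier} → (∀ i → i ≤ N → h i (N ∸ i) ≈ h′ i (N ∸ i)) →
                       binomialSum N h ≈ binomialSum N h′
    binomialSum-cong N h≈h′ = Σ-cong N (λ i i≤N → ·-cong R.refl (h≈h′ i i≤N))

    binomialSum-distrib : ∀ N (h h′ : ℕ → ℕ → Carrier) →
                          binomialSum N (λ i k → h i k + h′ i k) ≈ binomialSum N h + binomialSum N h′
    binomialSum-distrib N h h′ = trans (Σ-cong N (λ i _ → ·-distribˡ _ _ _)) (Σ-distrib N _ _)

    binomialSum-*ʳ : ∀ x N (h : ℕ → ℕ → Carrier) → binomialSum N h * x ≈ binomialSum N (λ i k → h i k * x)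
    binomialSum-*ʳ x N h = trans (Σ-*ʳ x N _) (Σ-cong N (λ i _ → *-·-assocˡ _ _ _))

    binomialSum-*ˡ : ∀ x N (h : ℕ → ℕ → Carrier) → x * binomialSum N h ≈ binomialSum N (λ i k → x * h i k)
    binomialSum-*ˡ x N h = trans (Σ-*ˡ x N _) (Σ-cong N (λ i _ → *-·-assocʳ _ _ _))

    binomialSum-suc : ∀ s (h : ℕ → ℕ → Carrier) →
      binomialSum (suc s) h ≈ binomialSum s (λ i k → h (suc i) k) + binomialSum s (λ i k → h i (suc k))
    binomialSum-suc s h = begin
      binomialSum (suc s) h                          ≈⟨ Σ-shift s _ ⟩
      term 0 + Σ s (λ i → term (suc i))              ≈⟨ +-cong (nC0·x≈x (suc s) _) (Σ-cong s (λ i _ → pascal i)) ⟩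
      h 0 (suc s) + Σ s (λ i → left i + right i)     ≈⟨ +-congˡ (Σ-distrib s left right) ⟩
      h 0 (suc s) + (Σ s left + Σ s right)           ≈⟨ x∙yz≈y∙xz _ _ _ ⟩
      Σ s left + (h 0 (suc s) + Σ s right)           ≈⟨ +-congˡ shifted ⟩
      binomialSum s (λ i k → h (suc i) k) + binomialSum s (λ i k → h i (suc k)) ∎
      where
      term left right shiftedTerm : ℕ → Carrier
      term i  = fromℕ R (suc s C i) · h i (suc s ∸ i)
      left i  = fromℕ R (s C i) · h (suc i) (s ∸ i)
      right i = fromℕ R (s C suc i) · h (suc i) (s ∸ i)
      shiftedTerm i = fromℕ R (s C i) · h i (suc s ∸ i)
      pascal : ∀ i → term (suc i) ≈ left i + right i
      pascal i = trans (·-cong (R.trans (fromℕ-cong (≡.sym (nCk+nC[k+1]≡[n+1]C[k+1] s i)))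
                                        (fromℕ-homo-+ (s C i) (s C suc i))) refl)
                       (·-distribʳ _ _ _)
      shifted : h 0 (suc s) + Σ s right ≈ binomialSum s (λ i k → h i (suc k))
      shifted = begin
        h 0 (suc s) + Σ s right                       ≈⟨ +-congʳ (nC0·x≈x s _) ⟨
        shiftedTerm 0 + Σ s (λ i → shiftedTerm (suc i)) ≈⟨ Σ-shift s shiftedTerm ⟨
        Σ (suc s) shiftedTerm                         ≈⟨ Σ-trunc (ℕ.n≤1+n s) (λ i s<i _ →
                                                           trans (·-cong (fromℕ-cong (k>n⇒nCk≡0 s<i)) refl) (·-zero _)) ⟩
        Σ s shiftedTerm                               ≈⟨ Σ-cong s (λ i i≤s → ·-cong R.refl
                                                           (reflexive (≡.cong (h i) (ℕ.+-∸-assoc 1 i≤s)))) ⟩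
        binomialSum s (λ i k → h i (suc k))           ∎

  binomialSum-one : ∀ h → binomialSum 1 h ≈ h 1 0 + h 0 1
  binomialSum-one h = trans (binomialSum-suc 0 h) (+-cong (binomialSum-zero _) (binomialSum-zero _))

  x−y≈0⇒y≈x : ∀ {x y} → x − y ≈ 0# → y ≈ x
  x−y≈0⇒y≈x {x} {y} x−y≈0 = begin
    y                 ≈⟨ +-identityʳ y ⟨
    y + 0#            ≈⟨ +-congˡ x−y≈0 ⟨
    y + (x − y)       ≈⟨ x∙yz≈y∙xz y x _ ⟩
    x + (y − y)       ≈⟨ +-congˡ (x−x≈0 y) ⟩
    x + 0#            ≈⟨ +-identityʳ x ⟩
    x                 ∎

module _ {c ℓ : Level} (R : CommutativeRing c ℓ) where
  open CommutativeRing R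
  open FiniteSums +-commutativeMonoid (sumTo R) (λ _ → refl) (λ _ _ → refl)
  open Scalars R using (fromℕ-cong)
  open import Relation.Nullary using (¬_)

  Xpd-diag : ∀ j → Xpd R j j ≡ 1#
  Xpd-diag zero    = ≡.refl
  Xpd-diag (suc j) = Xpd-diag j

  Xpd-off : ∀ j t → ¬ t ≡ j → Xpd R j t ≡ 0#
  Xpd-off zero    zero    t≢j = ⊥-elim (t≢j ≡.refl)
  Xpd-off zero    (suc t) _   = ≡.refl
  Xpd-off (suc j) zero    _   = ≡.refl
  Xpd-off (suc j) (suc t) t≢j = Xpd-off j t (λ t≡j → t≢j (≡.cong suc t≡j))

  ⋆-Xpd-term≈0 : ∀ (f : ℕ → Carrier) j N a → ¬ N ∸ a ≡ j → fromℕ R (N C a) * (f a * Xpd R j (N ∸ a)) ≈ 0#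
  ⋆-Xpd-term≈0 f j N a N∸a≢j =
    trans (*-congˡ (trans (*-congˡ (reflexive (Xpd-off j (N ∸ a) N∸a≢j))) (zeroʳ (f a)))) (zeroʳ _)

  ⋆-Xpd : ∀ f j N → j ≤ N → _⋆_ R f (Xpd R j) N ≈ fromℕ R (N C j) * f (N ∸ j)
  ⋆-Xpd f j N j≤N = trans (Σ-single (ℕ.m∸n≤m N j) vanishes) (*-cong (fromℕ-cong C-sym) atN∸j)
    where
    vanishes : ∀ a → a ≤ N → ¬ a ≡ N ∸ j → fromℕ R (N C a) * (f a * Xpd R j (N ∸ a)) ≈ 0#
    vanishes a a≤N a≢N∸j = ⋆-Xpd-term≈0 f j N a
      (λ N∸a≡j → a≢N∸j (≡.trans (≡.sym (ℕ.m∸[m∸n]≡n a≤N)) (≡.cong (N ∸_) N∸a≡j)))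
    C-sym : N C (N ∸ j) ≡ N C j
    C-sym = ≡.trans (nCk≡nC[n∸k] (ℕ.m∸n≤m N j)) (≡.cong (N C_) (ℕ.m∸[m∸n]≡n j≤N))
    atN∸j : f (N ∸ j) * Xpd R j (N ∸ (N ∸ j)) ≈ f (N ∸ j)
    atN∸j = trans (*-congˡ (reflexive (≡.trans (≡.cong (Xpd R j) (ℕ.m∸[m∸n]≡n j≤N)) (Xpd-diag j))))
                  (*-identityʳ _)

  ⋆-Xpd-< : ∀ f j N → N < j → _⋆_ R f (Xpd R j) N ≈ 0#
  ⋆-Xpd-< f j N N<j = Σ-zeros N (λ a _ → ⋆-Xpd-term≈0 f j N a
    (λ N∸a≡j → ℕ.<⇒≱ N<j (≡.subst (_≤ N) N∸a≡j (ℕ.m∸n≤m N a))))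

  coeffTerm-≤ : ∀ α n i j N → j ≤ N → i ≤ N ∸ j → coeffTerm R α n i j N
                ≈ fromℕ R (N C j) * (fromℕ R ((N ∸ j) C i) * invPow R α (n ℕ.+ i) (N ∸ j ∸ i))
  coeffTerm-≤ α n i j N j≤N i≤N∸j =
    trans (⋆-Xpd _ j N j≤N) (*-congˡ (⋆-Xpd (invPow R α (n ℕ.+ i)) i (N ∸ j) i≤N∸j))

  coeffTerm-> : ∀ α n i j N → j ≤ N → N ∸ j < i → coeffTerm R α n i j N ≈ 0#
  coeffTerm-> α n i j N j≤N N∸j<i =
    trans (⋆-Xpd _ j N j≤N) (trans (*-congˡ (⋆-Xpd-< (invPow R α (n ℕ.+ i)) i (N ∸ j) N∸j<i)) (zeroʳ _))

module Lemma3p6 {c ℓ a ℓa : Level} {R : CommutativeRing c ℓ} (𝔸 : Algebra R a ℓa)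
                (α : CommutativeRing.Carrier R) (A : ℕ → Algebra.Carrier 𝔸) where
  private module R = CommutativeRing R
  open AlgebraProperties 𝔸
  open Scalars R using (fromℕ-cong; fromℕ-homo-+; invPow-zero; invPow-suc)
  open import Relation.Binary.Reasoning.Setoid setoid
  open import Algebra.Properties.CommutativeSemigroup +-commutativeSemigroup using (interchange)
  open import Data.Maybe using (nothing)
  open import Tactic.RingSolver.Core.AlmostCommutativeRing using (fromCommutativeRing)
  open import Tactic.RingSolver.NonReflective (fromCommutativeRing R (λ _ → nothing))
  open import Algebra.Properties.Ring R.ring using (-‿distribˡ-*; -1*x≈-x)

  nα : ℕ → R.Carrier
  nα n = fromℕ R n R.* α

  factor⁺ factor⁻ : ℕ → Carrier
  factor⁺ m = ι (nα m) + A 1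
  factor⁻ d = ι (nα d) − A 1

  rising⁺ rising⁻ : ℕ → ℕ → Carrier
  rising⁺ e zero    = 1#
  rising⁺ e (suc j) = rising⁺ (suc e) j * factor⁺ e
  rising⁻ d zero    = 1#
  rising⁻ d (suc k) = rising⁻ (suc d) k * factor⁻ d

  Recurrence : Set ℓa
  Recurrence = ∀ m → A (suc m) ≈ A m * factor⁺ m

  closedForm : ℕ → Carrier
  closedForm zero    = A 1
  closedForm (suc n) = closedForm n * factor⁺ (suc n)

  Gterm : ℕ → ℕ → ℕ → ℕ → Carrier
  Gterm n d i k = (sign R i R.* invPow R α (d ℕ.+ (n ℕ.+ i)) k) · A (n ℕ.+ i)

  -- G n d is the coefficient sequence of  Σ_i (-1)^i A_{n+i} (1 - αX)^{-(d+n+i)} X^{[i]}.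
  G : ℕ → ℕ → ℕ → Carrier
  G n d s = binomialSum s (Gterm n d)

  lhs : ℕ → ℕ → Carrier
  lhs n N = Σ N (λ i → Σ N (λ j → (sign R i R.* coeffTerm R α n i j N) · (A (n ℕ.+ i) * A j)))

  A₁-commute-factor⁺ : ∀ m → Commute (A 1) (factor⁺ m)
  A₁-commute-factor⁺ m = commute-+ (sym (ι-commute _ (A 1))) refl

  factor⁺-commute : ∀ m m′ → Commute (factor⁺ m) (factor⁺ m′)
  factor⁺-commute m m′ = commute-+ (sym (ι-commute _ _)) (sym (A₁-commute-factor⁺ m))

  factor⁻-commute-rising⁺ : ∀ d e j → Commute (factor⁻ d) (rising⁺ e j)
  factor⁻-commute-rising⁺ d e zero    = trans (*-identityʳ _) (sym (*-identityˡ _))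
  factor⁻-commute-rising⁺ d e (suc j) = commute-* (factor⁻-commute-rising⁺ d (suc e) j) factor⁻-commute-factor⁺
    where
    factor⁻-commute-factor⁺ : Commute (factor⁻ d) (factor⁺ e)
    factor⁻-commute-factor⁺ = commute-+ (sym (ι-commute _ _))
      (sym (commute-+ (sym (ι-commute _ (A 1))) (commute-· (R.- R.1#) refl)))

  rising⁺-snoc : ∀ j e → rising⁺ e (suc j) ≈ rising⁺ e j * factor⁺ (e ℕ.+ j)
  rising⁺-snoc zero    e = *-congˡ (reflexive (≡.cong factor⁺ (≡.sym (ℕ.+-identityʳ e))))
  rising⁺-snoc (suc j) e = begin
    rising⁺ (suc e) (suc j) * factor⁺ e                      ≈⟨ *-congʳ (rising⁺-snoc j (suc e)) ⟩
    (rising⁺ (suc e) j * factor⁺ (suc e ℕ.+ j)) * factor⁺ e  ≈⟨ *-assoc _ _ _ ⟩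
    rising⁺ (suc e) j * (factor⁺ (suc e ℕ.+ j) * factor⁺ e)  ≈⟨ *-congˡ (factor⁺-commute (suc e ℕ.+ j) e) ⟩
    rising⁺ (suc e) j * (factor⁺ e * factor⁺ (suc e ℕ.+ j))  ≈⟨ *-assoc _ _ _ ⟨
    rising⁺ e (suc j) * factor⁺ (suc e ℕ.+ j)                ≡⟨ ≡.cong (λ t → rising⁺ e (suc j) * factor⁺ t) (ℕ.+-suc e j) ⟨
    rising⁺ e (suc j) * factor⁺ (e ℕ.+ suc j)                ∎

  recurrence⇒A≈rising⁺ : A 0 ≈ 1# → Recurrence → ∀ j → A j ≈ rising⁺ 0 j
  recurrence⇒A≈rising⁺ A₀≈1 rec zero    = A₀≈1
  recurrence⇒A≈rising⁺ A₀≈1 rec (suc j) =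
    trans (rec j) (trans (*-congʳ (recurrence⇒A≈rising⁺ A₀≈1 rec j)) (sym (rising⁺-snoc j 0)))

  recurrence⇒closedForm : Recurrence → ∀ n → A (suc n) ≈ closedForm n
  recurrence⇒closedForm rec zero    = refl
  recurrence⇒closedForm rec (suc n) = trans (rec (suc n)) (*-congʳ (recurrence⇒closedForm rec n))

  closedForm⇒recurrence : A 0 ≈ 1# → (∀ n → A (suc n) ≈ closedForm n) → Recurrence
  closedForm⇒recurrence A₀≈1 A≈closed zero = begin
    A 1                   ≈⟨ +-identityˡ (A 1) ⟨
    0# + A 1              ≈⟨ +-congʳ (trans (·-cong (R.zeroˡ α) refl) (·-zero 1#)) ⟨
    factor⁺ 0             ≈⟨ *-identityˡ _ ⟨
    1# * factor⁺ 0        ≈⟨ *-congʳ A₀≈1 ⟨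
    A 0 * factor⁺ 0       ∎
  closedForm⇒recurrence A₀≈1 A≈closed (suc m) =
    trans (A≈closed (suc m)) (*-congʳ (sym (A≈closed m)))

  *-factor⁺ : ∀ x m → x * factor⁺ m ≈ nα m · x + x * A 1
  *-factor⁺ x m = trans (distribˡ x _ _) (+-congʳ (ι-*ʳ _ x))

  *-factor⁻ : ∀ x d → x * factor⁻ d ≈ nα d · x − x * A 1
  *-factor⁻ x d = trans (distribˡ x _ _) (+-cong (ι-*ʳ _ x) (*-·-assocʳ _ x (A 1)))

  recurrence⇒A*factor⁻ : Recurrence → ∀ d m → nα (d ℕ.+ m) · A m − A (suc m) ≈ A m * factor⁻ d
  recurrence⇒A*factor⁻ rec d m = begin
    nα (d ℕ.+ m) · A m + R.- R.1# · A (suc m)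
      ≈⟨ +-cong (·-cong (R.trans (R.*-congʳ (fromℕ-homo-+ d m)) (R.distribʳ α _ _)) refl)
                (·-cong R.refl (trans (rec m) (*-factor⁺ (A m) m))) ⟩
    (nα d R.+ nα m) · A m + R.- R.1# · (nα m · A m + A m * A 1)
      ≈⟨ +-cong (·-distribʳ _ _ _) (·-distribˡ _ _ _) ⟩
    (nα d · A m + nα m · A m) + (R.- R.1# · (nα m · A m) + R.- R.1# · (A m * A 1))
      ≈⟨ +-congˡ (+-comm _ _) ⟩
    (nα d · A m + nα m · A m) + (R.- R.1# · (A m * A 1) + R.- R.1# · (nα m · A m))
      ≈⟨ interchange _ _ _ _ ⟩
    (nα d · A m − A m * A 1) + (nα m · A m − nα m · A m)
      ≈⟨ +-congˡ (x−x≈0 _) ⟩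
    (nα d · A m − A m * A 1) + 0#
      ≈⟨ +-identityʳ _ ⟩
    nα d · A m − A m * A 1
      ≈⟨ *-factor⁻ (A m) d ⟨
    A m * factor⁻ d ∎

  G-zero : ∀ n d → G n d 0 ≈ A n
  G-zero n d = begin
    G n d 0
      ≈⟨ binomialSum-zero (Gterm n d) ⟩
    (R.1# R.* invPow R α (d ℕ.+ (n ℕ.+ 0)) 0) · A (n ℕ.+ 0)
      ≈⟨ ·-cong (R.trans (R.*-identityˡ _) (invPow-zero α (d ℕ.+ (n ℕ.+ 0))))
                (reflexive (≡.cong A (ℕ.+-identityʳ n))) ⟩
    R.1# · A n
      ≈⟨ ·-identity (A n) ⟩
    A n ∎

  Gterm-pascal : Recurrence → ∀ n d i k →
    Gterm n d (suc i) k + Gterm n d i (suc k) ≈ Gterm n (suc d) i k * factor⁻ d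
  Gterm-pascal rec n d i k = begin
    (R.- σ R.* invPow R α (d ℕ.+ (n ℕ.+ suc i)) k) · A (n ℕ.+ suc i) + (σ R.* invPow R α (d ℕ.+ m) (suc k)) · A m
      ≡⟨ ≡.cong₂ (λ t u → (R.- σ R.* invPow R α t k) · A u + (σ R.* invPow R α (d ℕ.+ m) (suc k)) · A m)
                 (≡.trans (≡.cong (d ℕ.+_) (ℕ.+-suc n i)) (ℕ.+-suc d m)) (ℕ.+-suc n i) ⟩
    (R.- σ R.* p) · A (suc m) + (σ R.* invPow R α (d ℕ.+ m) (suc k)) · A m
      ≈⟨ +-congˡ (·-cong (R.*-congˡ (invPow-suc α (d ℕ.+ m) k)) refl) ⟩
    (R.- σ R.* p) · A (suc m) + (σ R.* (nα (d ℕ.+ m) R.* p)) · A m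
      ≈⟨ +-cong (·-cong (R.trans (R.sym (-‿distribˡ-* σ p)) (R.trans (R.sym (-1*x≈-x _)) (R.*-comm _ _))) refl)
                (·-cong (solve 3 (λ s c q → s ⊗ (c ⊗ q) ⊜ (s ⊗ q) ⊗ c) R.refl σ (nα (d ℕ.+ m)) p) refl) ⟩
    (σ R.* p R.* R.- R.1#) · A (suc m) + (σ R.* p R.* nα (d ℕ.+ m)) · A m
      ≈⟨ +-cong (·-assoc _ _ _) (·-assoc _ _ _) ⟩
    (σ R.* p) · (R.- R.1# · A (suc m)) + (σ R.* p) · (nα (d ℕ.+ m) · A m)
      ≈⟨ +-comm _ _ ⟩
    (σ R.* p) · (nα (d ℕ.+ m) · A m) + (σ R.* p) · (R.- R.1# · A (suc m))
      ≈⟨ ·-distribˡ _ _ _ ⟨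
    (σ R.* p) · (nα (d ℕ.+ m) · A m − A (suc m))
      ≈⟨ ·-cong R.refl (recurrence⇒A*factor⁻ rec d m) ⟩
    (σ R.* p) · (A m * factor⁻ d)
      ≈⟨ *-·-assocˡ _ _ _ ⟨
    Gterm n (suc d) i k * factor⁻ d ∎
    where
    m = n ℕ.+ i
    σ = sign R i
    p = invPow R α (suc d ℕ.+ m) k

  recurrence⇒G≈A*rising⁻ : Recurrence → ∀ n s d → G n d s ≈ A n * rising⁻ d s
  recurrence⇒G≈A*rising⁻ rec n zero    d = trans (G-zero n d) (sym (*-identityʳ (A n)))
  recurrence⇒G≈A*rising⁻ rec n (suc s) d = begin
    G n d (suc s)
      ≈⟨ binomialSum-suc s (Gterm n d) ⟩
    binomialSum s (λ i k → Gterm n d (suc i) k) + binomialSum s (λ i k → Gterm n d i (suc k))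
      ≈⟨ binomialSum-distrib s _ _ ⟨
    binomialSum s (λ i k → Gterm n d (suc i) k + Gterm n d i (suc k))
      ≈⟨ binomialSum-cong s (λ i _ → Gterm-pascal rec n d i (s ∸ i)) ⟩
    binomialSum s (λ i k → Gterm n (suc d) i k * factor⁻ d)
      ≈⟨ binomialSum-*ʳ (factor⁻ d) s (Gterm n (suc d)) ⟨
    G n (suc d) s * factor⁻ d
      ≈⟨ *-congʳ (recurrence⇒G≈A*rising⁻ rec n s (suc d)) ⟩
    A n * rising⁻ (suc d) s * factor⁻ d
      ≈⟨ *-assoc _ _ _ ⟩
    A n * rising⁻ d (suc s) ∎

  factor⁺+factor⁻ : ∀ e d → factor⁺ e + factor⁻ d ≈ ι (nα (d ℕ.+ e))
  factor⁺+factor⁻ e d = begin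
    (ι (nα e) + A 1) + (ι (nα d) − A 1)   ≈⟨ interchange _ _ _ _ ⟩
    (ι (nα e) + ι (nα d)) + (A 1 − A 1)   ≈⟨ +-cong (sym (·-distribʳ _ _ 1#)) (x−x≈0 (A 1)) ⟩
    ι (nα e R.+ nα d) + 0#                ≈⟨ +-identityʳ _ ⟩
    ι (nα e R.+ nα d)                     ≈⟨ ·-cong (R.trans (R.+-comm _ _) (R.sym (R.distribʳ α _ _))) refl ⟩
    ι ((fromℕ R d R.+ fromℕ R e) R.* α)   ≈⟨ ·-cong (R.*-congʳ (fromℕ-homo-+ d e)) refl ⟨
    ι (nα (d ℕ.+ e))                      ∎

  -- The coefficientwise form of (1 - αX)^{-(d - A₁/α)} (1 - αX)^{-(e + A₁/α)} = (1 - αX)^{-(d+e)}.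
  rising⁻⋆rising⁺ : ∀ N d e → binomialSum N (λ j k → rising⁻ d k * rising⁺ e j) ≈ ι (invPow R α (d ℕ.+ e) N)
  rising⁻⋆rising⁺ zero d e = begin
    binomialSum 0 (λ j k → rising⁻ d k * rising⁺ e j)  ≈⟨ binomialSum-zero (λ j k → rising⁻ d k * rising⁺ e j) ⟩
    1# * 1#                                            ≈⟨ *-identityˡ 1# ⟩
    1#                                                 ≈⟨ ·-identity 1# ⟨
    ι R.1#                                             ≈⟨ ·-cong (invPow-zero α (d ℕ.+ e)) refl ⟨
    ι (invPow R α (d ℕ.+ e) 0)                         ∎
  rising⁻⋆rising⁺ (suc N) d e = begin
    binomialSum (suc N) h
      ≈⟨ binomialSum-suc N h ⟩
    binomialSum N (λ j k → h (suc j) k) + binomialSum N (λ j k → h j (suc k))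
      ≈⟨ +-cong (binomialSum-cong N (λ j _ → sym (*-assoc _ _ _))) (binomialSum-cong N (λ j _ → move j (N ∸ j))) ⟩
    binomialSum N (λ j k → rising⁻ d k * rising⁺ (suc e) j * factor⁺ e)
      + binomialSum N (λ j k → rising⁻ (suc d) k * rising⁺ e j * factor⁻ d)
      ≈⟨ +-cong (binomialSum-*ʳ _ N _) (binomialSum-*ʳ _ N _) ⟨
    binomialSum N (λ j k → rising⁻ d k * rising⁺ (suc e) j) * factor⁺ e
      + binomialSum N (λ j k → rising⁻ (suc d) k * rising⁺ e j) * factor⁻ d
      ≈⟨ +-cong (*-congʳ (trans (rising⁻⋆rising⁺ N d (suc e))
                                (reflexive (≡.cong (λ t → ι (invPow R α t N)) (ℕ.+-suc d e)))))
                (*-congʳ (rising⁻⋆rising⁺ N (suc d) e)) ⟩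
    ι p * factor⁺ e + ι p * factor⁻ d
      ≈⟨ distribˡ (ι p) _ _ ⟨
    ι p * (factor⁺ e + factor⁻ d)
      ≈⟨ *-congˡ (factor⁺+factor⁻ e d) ⟩
    ι p * ι (nα (d ℕ.+ e))
      ≈⟨ ι-homo-* p _ ⟨
    ι (p R.* nα (d ℕ.+ e))
      ≈⟨ ·-cong (R.trans (R.*-comm _ _) (R.sym (invPow-suc α (d ℕ.+ e) N))) refl ⟩
    ι (invPow R α (d ℕ.+ e) (suc N)) ∎
    where
    p = invPow R α (suc (d ℕ.+ e)) N
    h : ℕ → ℕ → Carrier
    h j k = rising⁻ d k * rising⁺ e j
    move : ∀ j k → h j (suc k) ≈ rising⁻ (suc d) k * rising⁺ e j * factor⁻ d
    move j k = begin
      (rising⁻ (suc d) k * factor⁻ d) * rising⁺ e j  ≈⟨ *-assoc _ _ _ ⟩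
      rising⁻ (suc d) k * (factor⁻ d * rising⁺ e j)  ≈⟨ *-congˡ (factor⁻-commute-rising⁺ d e j) ⟩
      rising⁻ (suc d) k * (rising⁺ e j * factor⁻ d)  ≈⟨ *-assoc _ _ _ ⟨
      rising⁻ (suc d) k * rising⁺ e j * factor⁻ d    ∎

  lhs≈binomialSum : ∀ n N → lhs n N ≈ binomialSum N (λ j k → G n 0 k * A j)
  lhs≈binomialSum n N = begin
    lhs n N                                                  ≈⟨ Σ-comm N N _ ⟩
    Σ N (λ j → Σ N (λ i → t i j))                            ≈⟨ Σ-cong N column ⟩
    Σ N (λ j → fromℕ R (N C j) · (G n 0 (N ∸ j) * A j))      ≈⟨ binomialSum-unfold N _ ⟨
    binomialSum N (λ j k → G n 0 k * A j)                    ∎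
    where
    t : ℕ → ℕ → Carrier
    t i j = (sign R i R.* coeffTerm R α n i j N) · (A (n ℕ.+ i) * A j)
    column : ∀ j → j ≤ N → Σ N (λ i → t i j) ≈ fromℕ R (N C j) · (G n 0 (N ∸ j) * A j)
    column j j≤N = begin
      Σ N (λ i → t i j)                                              ≈⟨ Σ-trunc (ℕ.m∸n≤m N j) beyond ⟩
      Σ M (λ i → t i j)                                              ≈⟨ Σ-cong M within ⟩
      Σ M (λ i → cN · (fromℕ R (M C i) · (Gterm n 0 i (M ∸ i) * A j))) ≈⟨ Σ-· cN M _ ⟨
      cN · Σ M (λ i → fromℕ R (M C i) · (Gterm n 0 i (M ∸ i) * A j))   ≈⟨ ·-cong R.refl (binomialSum-unfold M _) ⟨
      cN · binomialSum M (λ i k → Gterm n 0 i k * A j)                 ≈⟨ ·-cong R.refl (binomialSum-*ʳ _ M _) ⟨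
      cN · (G n 0 M * A j)                                           ∎
      where
      M = N ∸ j
      cN = fromℕ R (N C j)
      beyond : ∀ i → M < i → i ≤ N → t i j ≈ 0#
      beyond i M<i _ =
        trans (·-cong (R.trans (R.*-congˡ (coeffTerm-> R α n i j N j≤N M<i)) (R.zeroʳ _)) refl) (·-zero _)
      within : ∀ i → i ≤ M → t i j ≈ cN · (fromℕ R (M C i) · (Gterm n 0 i (M ∸ i) * A j))
      within i i≤M = begin
        (σ R.* coeffTerm R α n i j N) · (A (n ℕ.+ i) * A j)
          ≈⟨ ·-cong (R.*-congˡ (coeffTerm-≤ R α n i j N j≤N i≤M)) refl ⟩
        (σ R.* (cN R.* (cM R.* p))) · (A (n ℕ.+ i) * A j)
          ≈⟨ ·-cong (solve 4 (λ s a b q → s ⊗ (a ⊗ (b ⊗ q)) ⊜ a ⊗ (b ⊗ (s ⊗ q))) R.refl σ cN cM p) refl ⟩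
        (cN R.* (cM R.* (σ R.* p))) · (A (n ℕ.+ i) * A j)
          ≈⟨ trans (·-assoc _ _ _) (·-cong R.refl (·-assoc _ _ _)) ⟩
        cN · (cM · ((σ R.* p) · (A (n ℕ.+ i) * A j)))
          ≈⟨ ·-cong R.refl (·-cong R.refl (*-·-assocˡ _ _ _)) ⟨
        cN · (cM · (Gterm n 0 i (M ∸ i) * A j)) ∎
        where
        σ = sign R i
        cM = fromℕ R (M C i)
        p = invPow R α (n ℕ.+ i) (M ∸ i)

  recurrence⇒lhs : A 0 ≈ 1# → Recurrence → ∀ n N → lhs n N ≈ invPow R α 0 N · A n
  recurrence⇒lhs A₀≈1 rec n N = begin
    lhs n N                                                    ≈⟨ lhs≈binomialSum n N ⟩
    binomialSum N (λ j k → G n 0 k * A j)                      ≈⟨ binomialSum-cong N (λ j _ → factorise j (N ∸ j)) ⟩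
    binomialSum N (λ j k → A n * (rising⁻ 0 k * rising⁺ 0 j))  ≈⟨ binomialSum-*ˡ (A n) N _ ⟨
    A n * binomialSum N (λ j k → rising⁻ 0 k * rising⁺ 0 j)    ≈⟨ *-congˡ (rising⁻⋆rising⁺ N 0 0) ⟩
    A n * ι (invPow R α 0 N)                                   ≈⟨ ι-*ʳ _ (A n) ⟩
    invPow R α 0 N · A n                                       ∎
    where
    factorise : ∀ j k → G n 0 k * A j ≈ A n * (rising⁻ 0 k * rising⁺ 0 j)
    factorise j k = trans (*-cong (recurrence⇒G≈A*rising⁻ rec n k 0) (recurrence⇒A≈rising⁺ A₀≈1 rec j))
                          (*-assoc _ _ _)

  G-one : ∀ n → G n 0 1 ≈ nα n · A n − A (suc n)
  G-one n = begin
    G n 0 1                          ≈⟨ binomialSum-one (Gterm n 0) ⟩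
    Gterm n 0 1 0 + Gterm n 0 0 1    ≈⟨ +-comm _ _ ⟩
    Gterm n 0 0 1 + Gterm n 0 1 0    ≈⟨ +-cong (·-cong coefficient (reflexive (≡.cong A (ℕ.+-identityʳ n))))
                                               (·-cong minusOne (reflexive (≡.cong A (ℕ.+-comm n 1)))) ⟩
    nα n · A n − A (suc n)           ∎
    where
    coefficient : R.1# R.* invPow R α (n ℕ.+ 0) 1 R.≈ nα n
    coefficient = R.trans (R.*-identityˡ _) (R.trans (invPow-suc α (n ℕ.+ 0) 0)
                  (R.trans (R.*-congˡ (invPow-zero α (suc (n ℕ.+ 0)))) (R.trans (R.*-identityʳ _)
                  (R.*-congʳ (fromℕ-cong (ℕ.+-identityʳ n))))))
    minusOne : R.- R.1# R.* invPow R α (n ℕ.+ 1) 0 R.≈ R.- R.1#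
    minusOne = R.trans (R.*-congˡ (invPow-zero α (n ℕ.+ 1))) (R.*-identityʳ _)

  lhs-1≈0⇒recurrence : A 0 ≈ 1# → (∀ n → lhs n 1 ≈ 0#) → Recurrence
  lhs-1≈0⇒recurrence A₀≈1 lhs≈0 n = x−y≈0⇒y≈x (begin
    A n * factor⁺ n − A (suc n)                        ≈⟨ +-congʳ (*-factor⁺ (A n) n) ⟩
    (nα n · A n + A n * A 1) − A (suc n)               ≈⟨ +-congʳ (+-comm _ _) ⟩
    (A n * A 1 + nα n · A n) − A (suc n)               ≈⟨ +-assoc _ _ _ ⟩
    A n * A 1 + (nα n · A n − A (suc n))               ≈⟨ +-cong (*-congʳ (G-zero n 0))
                                                                  (trans (*-identityʳ _) (G-one n)) ⟨
    G n 0 0 * A 1 + G n 0 1 * 1#                       ≈⟨ +-congˡ (*-congˡ A₀≈1) ⟨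
    G n 0 0 * A 1 + G n 0 1 * A 0                      ≈⟨ binomialSum-one (λ j k → G n 0 k * A j) ⟨
    binomialSum 1 (λ j k → G n 0 k * A j)              ≈⟨ lhs≈binomialSum n 1 ⟨
    lhs n 1                                            ≈⟨ lhs≈0 n ⟩
    0#                                                 ∎)

-- Torsion-freeness is not needed: on coefficients of X^{[N]} no division by integers occurs.
lemma3p6 : ∀ {c ℓ : Level} (R : CommutativeRing c ℓ) → TorsionFree R →
    ∀ (l : ℕ) (A : ℕ → Mat R l) (α : CommutativeRing.Carrier R) →
    _≈M_ R (A 0) (IM R) →
    ((∀ (n N : ℕ) → _≈M_ R (lhsCoeff R A α n N) (rhsCoeff R A n N)) →
      (∀ (n : ℕ) → _≈M_ R (A (suc n)) (prodA R (A 1) α n)))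
    × ((∀ (n : ℕ) → _≈M_ R (A (suc n)) (prodA R (A 1) α n)) →
      (∀ (n N : ℕ) → _≈M_ R (lhsCoeff R A α n N) (rhsCoeff R A n N)))
lemma3p6 R _ l A α A₀≈I = coefficients⇒product , product⇒coefficients
  where
  open AlgebraProperties (matrixAlgebra R l)
  open Lemma3p6 (matrixAlgebra R l) α A
  open Scalars R using (invPow-zero; invPow-0-suc)

  closedForm≡prodA : ∀ n → closedForm n ≡ prodA R (A 1) α n
  closedForm≡prodA zero    = ≡.refl
  closedForm≡prodA (suc n) = ≡.cong (λ P → P * factor⁺ (suc n)) (closedForm≡prodA n)

  coefficients⇒product : (∀ n N → lhs n N ≈ rhsCoeff R A n N) → ∀ n → A (suc n) ≈ prodA R (A 1) α n
  coefficients⇒product lhs≈rhs n = ≡.subst (A (suc n) ≈_) (closedForm≡prodA n)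
    (recurrence⇒closedForm (lhs-1≈0⇒recurrence A₀≈I (λ m → lhs≈rhs m 1)) n)

  product⇒coefficients : (∀ n → A (suc n) ≈ prodA R (A 1) α n) → ∀ n N → lhs n N ≈ rhsCoeff R A n N
  product⇒coefficients A≈prod n = rhs
    where
    rec : Recurrence
    rec = closedForm⇒recurrence A₀≈I (λ m → ≡.subst (A (suc m) ≈_) (≡.sym (closedForm≡prodA m)) (A≈prod m))
    rhs : ∀ N → lhs n N ≈ rhsCoeff R A n N
    rhs zero    = trans (recurrence⇒lhs A₀≈I rec n 0) (trans (·-cong (invPow-zero α 0) refl) (·-identity (A n)))
    rhs (suc N) = trans (recurrence⇒lhs A₀≈I rec n (suc N)) (trans (·-cong (invPow-0-suc α N) refl) (·-zero (A n)))
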